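{- Let $G$ be a connected simple graph and let $v\in V(G)$. Then $$\chi_{dom}(G)-\deg v+1\leq \chi_{dom}(G\odot v)\leq \chi_{dom}(G)+1.$$
   Context: A dominated coloring of a simple graph $H$ is a proper vertex coloring of $H$ such that every color class is dominated by at least one vertex, i.e. for each color class $C$ there is a vertex $x$ of $H$ adjacent to every vertex of $C$. The dominated chromatic number $\chi_{dom}(H)$ is the minimum number of colors in a dominated coloring of $H$. $G\odot v$ denotes the graph obtained from $G$ by removing all edges between any pair of neighbours of $v$ (the vertex $v$ itself and all other edges are kept). -}

module Defs where

open import Data.Nat using (ℕ; _+_; _≤_)
open import Data.Fin using (Fin)
open import Data.Bool using (Bool; true; false; _∧_; not; if_then_else_)
open import Data.Bool.Properties using (∧-comm)
open import Data.List using (List; map; allFin)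
open import Data.Nat.ListAction using (sum)
open import Data.Product using (Σ; ∃; _×_; _,_)
open import Relation.Binary.PropositionalEquality using (_≡_; _≢_; refl; cong; cong₂)

record SimpleGraph (n : ℕ) : Set where
  field
    adj    : Fin n → Fin n → Bool
    adj-sym    : ∀ i j → adj i j ≡ adj j i
    adj-irrefl : ∀ i → adj i i ≡ false

open SimpleGraph public

Adjacent : ∀ {n} → SimpleGraph n → Fin n → Fin n → Set
Adjacent G i j = adj G i j ≡ true

degree : ∀ {n} → SimpleGraph n → Fin n → ℕ
degree {n} G v = sum (map (λ j → if adj G v j then 1 else 0) (allFin n))

data Walk {n} (G : SimpleGraph n) : Fin n → Fin n → Set where
  nil  : ∀ {i} → Walk G i i
  cons : ∀ {i j k} → Adjacent G i j → Walk G j k → Walk G i k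

Connected : ∀ {n} → SimpleGraph n → Set
Connected {n} G = ∀ (i j : Fin n) → Walk G i j

private
  odot-sym : ∀ {n} (G : SimpleGraph n) (v i j : Fin n) →
    (adj G i j ∧ not (adj G v i ∧ adj G v j)) ≡ (adj G j i ∧ not (adj G v j ∧ adj G v i))
  odot-sym G v i j = cong₂ _∧_ (adj-sym G i j) (cong not (∧-comm (adj G v i) (adj G v j)))

  odot-irrefl : ∀ {n} (G : SimpleGraph n) (v i : Fin n) →
    (adj G i i ∧ not (adj G v i ∧ adj G v i)) ≡ false
  odot-irrefl G v i with adj G i i | adj-irrefl G i
  ... | .false | refl = refl

_⊙_ : ∀ {n} → SimpleGraph n → Fin n → SimpleGraph n
adj (G ⊙ v) i j = adj G i j ∧ not (adj G v i ∧ adj G v j)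
adj-sym (G ⊙ v) = odot-sym G v
adj-irrefl (G ⊙ v) = odot-irrefl G v

IsProperColoring : ∀ {n k} → SimpleGraph n → (Fin n → Fin k) → Set
IsProperColoring G c = ∀ i j → Adjacent G i j → c i ≢ c j

IsDominatedColoring : ∀ {n k} → SimpleGraph n → (Fin n → Fin k) → Set
IsDominatedColoring {n} {k} G c =
  IsProperColoring G c × (∀ (a : Fin k) → ∃ λ (x : Fin n) → ∀ i → c i ≡ a → Adjacent G x i)

HasDominatedColoring : ∀ {n} → SimpleGraph n → ℕ → Set
HasDominatedColoring {n} G k = ∃ λ (c : Fin n → Fin k) → IsDominatedColoring G c

IsDomChromaticNumber : ∀ {n} → SimpleGraph n → ℕ → Set
IsDomChromaticNumber G k = HasDominatedColoring G k × (∀ m → HasDominatedColoring G m → k ≤ m)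

module Submission where

-- Both inequalities come from explicit recolourings.
--
-- A dominated colouring of G with k colours gives one of
--   G ⊙ v with k + 1 colours: give every neighbour of v the new colour k.
--   The neighbours of v are independent in G ⊙ v and all adjacent to v,
--   and the old classes lose only neighbours of v, so their dominators
--   stay adjacent to them in G ⊙ v.
-- * Lower bound.  A dominated colouring of G ⊙ v with k' colours gives one
--   of G with k' + (deg v - 1) colours: list the neighbours of v in order,
--   keep the colour of the first one and give the others pairwise distinct
--   fresh colours.  Every fresh class is a single neighbour of v, hence
--   dominated by v; the only edges of G not in G ⊙ v join two neighbours
--   of v, and at most one of those keeps an old colour.
--   Since v's own colour class is dominated, deg v ≥ 1, which turns
--   k ≤ k' + (deg v - 1) into k + 1 ≤ k' + deg v.

open import Defs
open import Data.Nat using (ℕ; zero; suc; _+_; _∸_; _≤_; _<_; z≤n; s≤s; _<?_)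
open import Data.Nat.Properties
  using (<-≤-trans; ≤-<-trans; <⇒≱; ≮⇒≥; n≮n; m+n≮m;
         m≤m+n; m<m+n; +-monoʳ-<; +-monoˡ-≤; +-cancelˡ-≡; +-assoc; m∸n+n≡m; pred-mono-<;
         module ≤-Reasoning)
open import Data.Fin using (Fin; toℕ; fromℕ<) renaming (zero to fzero; suc to fsuc)
open import Data.Fin.Properties using (toℕ-injective; toℕ-fromℕ<; toℕ<n)
open import Data.Bool using (Bool; true; false; _∧_; not; if_then_else_)
open import Data.Bool.Properties using (∧-zeroʳ)
open import Data.List using (tabulate)
open import Data.List.Properties using (map-tabulate)
open import Data.Nat.ListAction using (sum)
open import Data.Product using (∃; _×_; _,_; proj₁; proj₂)
open import Data.Sum using (_⊎_; inj₁; inj₂)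
open import Data.Empty using (⊥)
open import Relation.Nullary using (yes; no; contradiction)
open import Relation.Binary.PropositionalEquality
  using (_≡_; _≢_; refl; sym; trans; cong; subst)
open import Function using (_∘_; id)

indicator : Bool → ℕ
indicator b = if b then 1 else 0

count : ∀ {n} → (Fin n → Bool) → ℕ
count {zero}  p = 0
count {suc n} p = indicator (p fzero) + count (p ∘ fsuc)

rank : ∀ {n} → (Fin n → Bool) → Fin n → ℕ
rank p fzero    = 0
rank p (fsuc i) = indicator (p fzero) + rank (p ∘ fsuc) i

rank<count : ∀ {n} (p : Fin n → Bool) i → p i ≡ true → rank p i < count p
rank<count p fzero    pi rewrite pi = s≤s z≤n
rank<count p (fsuc i) pi = +-monoʳ-< (indicator (p fzero)) (rank<count (p ∘ fsuc) i pi)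

rank-injective : ∀ {n} (p : Fin n → Bool) {i j} → p i ≡ true → p j ≡ true →
                 rank p i ≡ rank p j → i ≡ j
rank-injective p {fzero}  {fzero}  _  _  _ = refl
rank-injective p {fzero}  {fsuc j} pi _  r rewrite pi with () ← r
rank-injective p {fsuc i} {fzero}  _  pj r rewrite pj with () ← r
rank-injective p {fsuc i} {fsuc j} pi pj r =
  cong fsuc (rank-injective (p ∘ fsuc) pi pj (+-cancelˡ-≡ (indicator (p fzero)) _ _ r))

count-pos : ∀ {n} (p : Fin n → Bool) {i} → p i ≡ true → 0 < count p
count-pos p {i} pi = ≤-<-trans z≤n (rank<count p i pi)

sum-tabulate : ∀ {n} (p : Fin n → Bool) → sum (tabulate (indicator ∘ p)) ≡ count p
sum-tabulate {zero}  p = refl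
sum-tabulate {suc n} p = cong (indicator (p fzero) +_) (sum-tabulate (p ∘ fsuc))

degree≡count : ∀ {n} (G : SimpleGraph n) v → degree G v ≡ count (adj G v)
degree≡count G v =
  trans (cong sum (map-tabulate id (indicator ∘ adj G v))) (sum-tabulate (adj G v))

module _ {n} (G : SimpleGraph n) (v : Fin n) where

  ⊙-sub : ∀ {i j} → Adjacent (G ⊙ v) i j → Adjacent G i j
  ⊙-sub {i} {j} e with adj G i j
  ... | true = refl

  ⊙-keepsˡ : ∀ {i j} → Adjacent G i j → adj G v i ≡ false → Adjacent (G ⊙ v) i j
  ⊙-keepsˡ e vi rewrite e | vi = refl

  ⊙-keepsʳ : ∀ {i j} → Adjacent G i j → adj G v j ≡ false → Adjacent (G ⊙ v) i j
  ⊙-keepsʳ {i} e vj rewrite e | vj | ∧-zeroʳ (adj G v i) = refl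

  ⊙-independent : ∀ {i j} → Adjacent (G ⊙ v) i j → Adjacent G v i → Adjacent G v j → ⊥
  ⊙-independent {i} {j} e vi vj rewrite vi | vj | ∧-zeroʳ (adj G i j) with () ← e

  ⊙-star : ∀ {i} → Adjacent G v i → Adjacent (G ⊙ v) v i
  ⊙-star vi rewrite vi | adj-irrefl G v = refl

-- case split on adjacency that does not abstract adj G i j in the goal
adjacent? : ∀ {n} (G : SimpleGraph n) i j → Adjacent G i j ⊎ adj G i j ≡ false
adjacent? G i j with adj G i j
... | true  = inj₁ refl
... | false = inj₂ refl

adjacent⇒distinct : ∀ {n} (G : SimpleGraph n) {i j} → Adjacent G i j → i ≢ j
adjacent⇒distinct G {i} e refl with () ← trans (sym e) (adj-irrefl G i)

-- In a graph with a dominated colouring every vertex has a neighbour: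
-- some vertex dominates its colour class.
dominated⇒degree-pos : ∀ {n k} (G : SimpleGraph n) v →
                       HasDominatedColoring G k → 0 < degree G v
dominated⇒degree-pos G v (c , _ , dominated) =
  subst (0 <_) (sym (degree≡count G v))
        (count-pos (adj G v) (trans (adj-sym G v x) (x-dominates v refl)))
  where
  x = proj₁ (dominated (c v))
  x-dominates = proj₂ (dominated (c v))

dominated-fromℕ : ∀ {n} (H : SimpleGraph n) (m : ℕ) (col : Fin n → ℕ) →
  (∀ i → col i < m) →
  (∀ i j → Adjacent H i j → col i ≢ col j) →
  (∀ a → a < m → ∃ λ x → ∀ i → col i ≡ a → Adjacent H x i) →
  HasDominatedColoring H m
dominated-fromℕ {n} H m col bounded proper dominated =
  colour , colour-proper , colour-dominated
  where
  colour : Fin n → Fin m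
  colour i = fromℕ< (bounded i)

  toℕ-colour : ∀ i → toℕ (colour i) ≡ col i
  toℕ-colour i = toℕ-fromℕ< (bounded i)

  colour-proper : IsProperColoring H colour
  colour-proper i j e same =
    proper i j e (trans (sym (toℕ-colour i)) (trans (cong toℕ same) (toℕ-colour j)))

  colour-dominated : ∀ a → ∃ λ x → ∀ i → colour i ≡ a → Adjacent H x i
  colour-dominated a with dominated (toℕ a) (toℕ<n a)
  ... | x , x-dominates = x , λ i ci≡a → x-dominates i (trans (sym (toℕ-colour i)) (cong toℕ ci≡a))

class-of : ∀ {n k} (c : Fin n → Fin k) {i a} (a<k : a < k) → toℕ (c i) ≡ a → c i ≡ fromℕ< a<k
class-of c a<k e = toℕ-injective (trans e (sym (toℕ-fromℕ< a<k)))

module Upper {n} (G : SimpleGraph n) (v : Fin n) {k} (c : Fin n → Fin k)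
             (c-dominated : IsDominatedColoring G c) where

  colour : Fin n → ℕ
  colour i = if adj G v i then k else toℕ (c i)

  non-neighbour-colour : ∀ {i} → adj G v i ≡ false → colour i ≡ toℕ (c i)
  non-neighbour-colour {i} vi = cong (λ b → if b then k else toℕ (c i)) vi

  low⇒non-neighbour : ∀ i → colour i < k → adj G v i ≡ false
  low⇒non-neighbour i lt with adj G v i
  ... | false = refl
  ... | true  = contradiction lt (n≮n k)

  high⇒neighbour : ∀ i → k ≤ colour i → Adjacent G v i
  high⇒neighbour i ge with adj G v i
  ... | true  = refl
  ... | false = contradiction ge (<⇒≱ (toℕ<n (c i)))

  bounded : ∀ i → colour i < k + 1
  bounded i with adj G v i
  ... | true  = m<m+n k (s≤s z≤n)
  ... | false = <-≤-trans (toℕ<n (c i)) (m≤m+n k 1)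

  proper : ∀ i j → Adjacent (G ⊙ v) i j → colour i ≢ colour j
  proper i j e same with colour i <? k
  ... | yes lt = proj₁ c-dominated i j (⊙-sub G v e) (toℕ-injective old-same)
    where
    vi = low⇒non-neighbour i lt
    vj = low⇒non-neighbour j (subst (_< k) same lt)
    old-same : toℕ (c i) ≡ toℕ (c j)
    old-same = trans (sym (non-neighbour-colour vi)) (trans same (non-neighbour-colour vj))
  ... | no ge = ⊙-independent G v e (high⇒neighbour i (≮⇒≥ ge))
                                    (high⇒neighbour j (subst (k ≤_) same (≮⇒≥ ge)))

  dominated : ∀ a → a < k + 1 → ∃ λ x → ∀ i → colour i ≡ a → Adjacent (G ⊙ v) x i
  dominated a _ with a <? k
  ... | yes a<k with proj₂ c-dominated (fromℕ< a<k)
  ...   | x , x-dominates = x , x-dominates⊙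
    where
    x-dominates⊙ : ∀ i → colour i ≡ a → Adjacent (G ⊙ v) x i
    x-dominates⊙ i ci≡a = ⊙-keepsʳ G v (x-dominates i (class-of c a<k (trans (sym (non-neighbour-colour vi)) ci≡a))) vi
      where vi = low⇒non-neighbour i (subst (_< k) (sym ci≡a) a<k)
  dominated a _ | no a≮k =
    v , λ i ci≡a → ⊙-star G v (high⇒neighbour i (subst (k ≤_) (sym ci≡a) (≮⇒≥ a≮k)))

  colouring : HasDominatedColoring (G ⊙ v) (k + 1)
  colouring = dominated-fromℕ (G ⊙ v) (k + 1) colour bounded proper dominated

module Lower {n} (G : SimpleGraph n) (v : Fin n) {k'} (c' : Fin n → Fin k')
             (c'-dominated : IsDominatedColoring (G ⊙ v) c') where

  d : ℕ
  d = count (adj G v)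

  -- new colour of a vertex from (is it a neighbour?, old colour, rank):
  -- the neighbour of rank 0 keeps its colour, rank s + 1 gets k' + s
  recolour : Bool → ℕ → ℕ → ℕ
  recolour false o r       = o
  recolour true  o zero    = o
  recolour true  o (suc s) = k' + s

  data Recoloured (b : Bool) (o r : ℕ) : Set where
    kept  : recolour b o r ≡ o → (b ≡ true → r ≡ 0) → Recoloured b o r
    fresh : ∀ s → b ≡ true → r ≡ suc s → recolour b o r ≡ k' + s → Recoloured b o r

  classify : ∀ b o r → Recoloured b o r
  classify false o r       = kept refl λ ()
  classify true  o zero    = kept refl λ _ → refl
  classify true  o (suc s) = fresh s refl refl refl

  colour : Fin n → ℕ
  colour i = recolour (adj G v i) (toℕ (c' i)) (rank (adj G v) i)

  status : ∀ i → Recoloured (adj G v i) (toℕ (c' i)) (rank (adj G v) i)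
  status i = classify (adj G v i) (toℕ (c' i)) (rank (adj G v) i)

  old≢fresh : ∀ i s → toℕ (c' i) ≢ k' + s
  old≢fresh i s e = m+n≮m k' s (subst (_< k') e (toℕ<n (c' i)))

  low⇒kept : ∀ i → colour i < k' → colour i ≡ toℕ (c' i)
  low⇒kept i lt with status i
  ... | kept e _      = e
  ... | fresh s _ _ e = contradiction (subst (_< k') e lt) (m+n≮m k' s)

  high⇒neighbour : ∀ i → k' ≤ colour i → Adjacent G v i
  high⇒neighbour i ge with status i
  ... | kept e _       = contradiction (subst (k' ≤_) e ge) (<⇒≱ (toℕ<n (c' i)))
  ... | fresh _ vi _ _ = vi

  neighbour-injective : ∀ {i j} → Adjacent G v i → Adjacent G v j → colour i ≡ colour j → i ≡ j
  neighbour-injective {i} {j} vi vj same with status i | status j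
  ... | kept _ ri | kept _ rj =
    rank-injective (adj G v) vi vj (trans (ri vi) (sym (rj vj)))
  ... | kept ei _ | fresh t _ _ ej = contradiction (trans (sym ei) (trans same ej)) (old≢fresh i t)
  ... | fresh s _ _ ei | kept ej _ = contradiction (trans (sym ej) (trans (sym same) ei)) (old≢fresh j s)
  ... | fresh s _ ri ei | fresh t _ rj ej =
    rank-injective (adj G v) vi vj
      (trans ri (trans (cong suc (+-cancelˡ-≡ k' s t (trans (sym ei) (trans same ej)))) (sym rj)))

  bounded : ∀ i → colour i < k' + (d ∸ 1)
  bounded i with status i
  ... | kept e _ = subst (_< k' + (d ∸ 1)) (sym e) (<-≤-trans (toℕ<n (c' i)) (m≤m+n k' _))
  ... | fresh s vi ri e = subst (_< k' + (d ∸ 1)) (sym e)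
          (+-monoʳ-< k' (pred-mono-< (subst (_< d) ri (rank<count (adj G v) i vi))))

  old-same : ∀ i j → adj G v i ≡ false → colour i ≡ colour j → c' i ≡ c' j
  old-same i j vi same =
    toℕ-injective (trans (sym ci) (trans same (low⇒kept j (subst (_< k') same lt))))
    where
    ci : colour i ≡ toℕ (c' i)
    ci = cong (λ b → recolour b (toℕ (c' i)) (rank (adj G v) i)) vi
    lt : colour i < k'
    lt = subst (_< k') (sym ci) (toℕ<n (c' i))

  -- only edges inside N(v) are missing from G ⊙ v, and N(v) is coloured injectively
  proper : ∀ i j → Adjacent G i j → colour i ≢ colour j
  proper i j e same with adjacent? G v i | adjacent? G v j
  ... | inj₁ vi | inj₁ vj = adjacent⇒distinct G e (neighbour-injective vi vj same)
  ... | inj₂ vi | _       = proj₁ c'-dominated i j (⊙-keepsˡ G v e vi) (old-same i j vi same)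
  ... | inj₁ _  | inj₂ vj = proj₁ c'-dominated i j (⊙-keepsʳ G v e vj) (sym (old-same j i vj (sym same)))

  -- old classes keep their dominators, fresh classes lie in N(v)
  dominated : ∀ a → a < k' + (d ∸ 1) → ∃ λ x → ∀ i → colour i ≡ a → Adjacent G x i
  dominated a _ with a <? k'
  ... | yes a<k' with proj₂ c'-dominated (fromℕ< a<k')
  ...   | x , x-dominates = x , λ i ci≡a →
          ⊙-sub G v (x-dominates i (class-of c' a<k'
            (trans (sym (low⇒kept i (subst (_< k') (sym ci≡a) a<k'))) ci≡a)))
  dominated a _ | no a≮k' =
    v , λ i ci≡a → high⇒neighbour i (subst (k' ≤_) (sym ci≡a) (≮⇒≥ a≮k'))

  colouring : HasDominatedColoring G (k' + (degree G v ∸ 1))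
  colouring rewrite degree≡count G v = dominated-fromℕ G (k' + (d ∸ 1)) colour bounded proper dominated

shift-pred : ∀ {k k' d} → 0 < d → k ≤ k' + (d ∸ 1) → k + 1 ≤ k' + d
shift-pred {k} {k'} {d} d>0 k≤ = begin
  k + 1             ≤⟨ +-monoˡ-≤ 1 k≤ ⟩
  k' + (d ∸ 1) + 1  ≡⟨ +-assoc k' (d ∸ 1) 1 ⟩
  k' + (d ∸ 1 + 1)  ≡⟨ cong (k' +_) (m∸n+n≡m d>0) ⟩
  k' + d            ∎
  where open ≤-Reasoning

mainTheorem8 : ∀ {n} (G : SimpleGraph n) (v : Fin n) → Connected G →
    ∀ (k k' : ℕ) → IsDomChromaticNumber G k → IsDomChromaticNumber (G ⊙ v) k' →
    (k + 1 ≤ k' + degree G v) × (k' ≤ k + 1)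
mainTheorem8 G v _ k k' (G-colourable@(c , c-dominated) , k-minimal)
                        ((c' , c'-dominated) , k'-minimal) =
  lower , upper
  where
  lower : k + 1 ≤ k' + degree G v
  lower = shift-pred (dominated⇒degree-pos G v G-colourable)
                     (k-minimal _ (Lower.colouring G v c' c'-dominated))

  upper : k' ≤ k + 1
  upper = k'-minimal _ (Upper.colouring G v c c-dominated)
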